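{- Let $T$ be a finite rooted tree with node set $\mathcal V$, cost function $c:\mathcal V\to\mathbb R_{\ge0}$, integer budget $B\ge1$, and importance function $r:\mathcal V\to\mathbb R_{>0}$. Let $\mathbf v$ be a hypernode with $S(\mathbf v)\ne\emptyset$. Then \[\mathrm{Var}\big(|\mathbf v|C_{\mathrm{SEI}}(T_{\mathbf v})\big)=\sum_{\mathbf w\in H(\mathbf v)}\frac{1}{\binom{|S(\mathbf v)|-1}{|\mathbf w|-1}}\frac{r(S(\mathbf v))}{r(\mathbf w)}\Big(\mathrm{Var}\big(|\mathbf w|C_{\mathrm{SEI}}(T_{\mathbf w})\big)+\mathrm{Cost}(T_{\mathbf w})^2\Big)-\mathrm{Cost}(T_{S(\mathbf v)})^2,\] where $C_{\mathrm{SEI}}(T_{\mathbf u})$ denotes the output of the SEI algorithm started at the hypernode $\mathbf u$.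
   Context: For a node $v$, $S(v)$ is its set of children and $T_v$ is the subtree rooted at $v$, with $\mathrm{Cost}(T_v)=\sum_{u\in T_v}c(u)$. A hypernode is a set of distinct nodes of $T$ all at the same depth. For a set of nodes $\mathbf v$: $c(\mathbf v)=\sum_{v\in\mathbf v}c(v)$, $r(\mathbf v)=\sum_{v\in\mathbf v}r(v)$, $S(\mathbf v)=\bigcup_{v\in\mathbf v}S(v)$, $T_{\mathbf v}=\bigcup_{v\in\mathbf v}T_v$, and $\mathrm{Cost}(T_{\mathbf v})=\sum_{v\in\mathbf v}\mathrm{Cost}(T_v)$. The hyperchildren of $\mathbf v$ are $H(\mathbf v)=\{\mathbf w\subseteq S(\mathbf v): |\mathbf w|=\min(B,|S(\mathbf v)|)\}$. SEI algorithm started at $\mathbf v$: set $k=0$, $\mathbf x_0=\mathbf v$, $D=1$, $C=c(\mathbf x_0)/|\mathbf x_0|$. Repeat: if $S(\mathbf x_k)=\emptyset$, stop and output $C_{\mathrm{SEI}}(T_{\mathbf v})=C$. Otherwise choose $\mathbf x_{k+1}\in H(\mathbf x_k)$ by first choosing $x\in S(\mathbf x_k)$ with probability $r(x)/r(S(\mathbf x_k))$ and then choosing the remaining $\min(B,|S(\mathbf x_k)|)-1$ elements of $\mathbf x_{k+1}$ as a uniformly random subset of $S(\mathbf x_k)\setminus\{x\}$ (fresh randomness at each step); set $D_k=\frac{|\mathbf x_{k+1}|}{|\mathbf x_k|}\cdot\frac{r(S(\mathbf x_k))}{r(\mathbf x_{k+1})}$, $D\leftarrow D\cdot D_k$, $C\leftarrow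 C+\frac{c(\mathbf x_{k+1})}{|\mathbf x_{k+1}|}D$, $k\leftarrow k+1$. -}

module Defs where

open import Level using (Level) renaming (suc to lsuc)
open import Data.Nat as ℕ using (ℕ; zero; suc; _⊔_)
open import Data.Nat.Combinatorics using (_C_)
open import Data.List using (List; []; _∷_; _++_; map; concat; concatMap; length; foldr)
open import Data.Product using (_×_; _,_; proj₁; proj₂)
open import Relation.Binary.Core using (Rel)
open import Relation.Binary.Structures using (IsTotalOrder)
open import Relation.Nullary using (¬_)
open import Algebra.Core using (Op₁; Op₂)
open import Algebra.Structures using (IsCommutativeRing)

-- An ordered field (the real numbers are a model).  The inverse is a
-- total operation; it is only constrained on nonzero arguments.

record OrderedField c ℓ₁ ℓ₂ : Set (lsuc (c Level.⊔ ℓ₁ Level.⊔ ℓ₂)) where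
  infixl 7 _*_
  infixl 6 _+_ _-_
  infix 4 _≈_ _≤_ _<_
  infix 8 -_
  infix 9 _⁻¹
  field
    Carrier : Set c
    _≈_ : Rel Carrier ℓ₁
    _≤_ : Rel Carrier ℓ₂
    _+_ : Op₂ Carrier
    _*_ : Op₂ Carrier
    -_ : Op₁ Carrier
    0# : Carrier
    1# : Carrier
    _⁻¹ : Op₁ Carrier
    isCommutativeRing : IsCommutativeRing _≈_ _+_ _*_ -_ 0# 1#
    isTotalOrder : IsTotalOrder _≈_ _≤_
    0≉1 : ¬ (0# ≈ 1#)
    ⁻¹-cong : ∀ {x y} → x ≈ y → x ⁻¹ ≈ y ⁻¹
    ⁻¹-inverse : ∀ x → ¬ (x ≈ 0#) → x * x ⁻¹ ≈ 1#
    +-monoˡ-≤ : ∀ {x y} z → x ≤ y → x + z ≤ y + z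
    *-nonneg : ∀ {x y} → 0# ≤ x → 0# ≤ y → 0# ≤ x * y

  _-_ : Op₂ Carrier
  x - y = x + (- y)

  _/_ : Op₂ Carrier
  x / y = x * y ⁻¹

  _<_ : Rel Carrier (ℓ₁ Level.⊔ ℓ₂)
  x < y = (x ≤ y) × ¬ (x ≈ y)

  fromℕ : ℕ → Carrier
  fromℕ zero = 0#
  fromℕ (suc n) = 1# + fromℕ n

  Σ : List Carrier → Carrier
  Σ = foldr _+_ 0#

module SEI {c ℓ₁ ℓ₂} (F : OrderedField c ℓ₁ ℓ₂) where
  open OrderedField F

  data Tree : Set c where
    node : (cost : Carrier) (imp : Carrier) (children : List Tree) → Tree

  cst : Tree → Carrier
  cst (node x _ _) = x

  imp : Tree → Carrier
  imp (node _ y _) = y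

  kids : Tree → List Tree
  kids (node _ _ ts) = ts

  mutual
    Cost : Tree → Carrier
    Cost (node x _ ts) = x + Costs ts

    Costs : List Tree → Carrier
    Costs [] = 0#
    Costs (t ∷ ts) = Cost t + Costs ts

  mutual
    nodes : Tree → List Tree
    nodes t@(node _ _ ts) = t ∷ nodesL ts

    nodesL : List Tree → List Tree
    nodesL [] = []
    nodesL (t ∷ ts) = nodes t ++ nodesL ts

  mutual
    height : Tree → ℕ
    height (node _ _ ts) = suc (heightL ts)

    heightL : List Tree → ℕ
    heightL [] = 0
    heightL (t ∷ ts) = height t ⊔ heightL ts

  mutual
    level : ℕ → Tree → List Tree
    level zero t = t ∷ []
    level (suc d) (node _ _ ts) = levelL d ts

    levelL : ℕ → List Tree → List Tree
    levelL d [] = []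
    levelL d (t ∷ ts) = level d t ++ levelL d ts

  -- A hypernode / set of nodes is represented by the list of its (distinct)
  -- nodes.  For such a list 𝐯:
  ∣_∣ : List Tree → Carrier
  ∣ vs ∣ = fromℕ (length vs)

  c* : List Tree → Carrier
  c* vs = Σ (map cst vs)

  r* : List Tree → Carrier
  r* vs = Σ (map imp vs)

  S* : List Tree → List Tree
  S* vs = concatMap kids vs

  Cost* : List Tree → Carrier
  Cost* = Costs

  choose : {A : Set c} → ℕ → List A → List (List A)
  choose zero xs = [] ∷ []
  choose (suc k) [] = []
  choose (suc k) (x ∷ xs) = map (x ∷_) (choose k xs) ++ choose (suc k) xs

  picks : {A : Set c} → List A → List (A × List A)
  picks [] = []
  picks (x ∷ xs) = (x , xs) ∷ map (λ { (y , ys) → y , x ∷ ys }) (picks xs)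

  H : ℕ → List Tree → List (List Tree)
  H B vs = choose (B ℕ.⊓ length (S* vs)) (S* vs)

  -- Finite probability distributions of field-valued random variables:
  -- lists of (probability , value) pairs.

  Dist : Set c
  Dist = List (Carrier × Carrier)

  E : Dist → Carrier
  E d = Σ (map (λ { (p , x) → p * x }) d)

  Var : Dist → Carrier
  Var d = E (map (λ { (p , x) → p , x * x }) d) - E d * E d

  scaleBy : Carrier → Dist → Dist
  scaleBy a d = map (λ { (p , x) → p , a * x }) d

  weight : Carrier → Dist → Dist
  weight q d = map (λ { (p , x) → q * p , x }) d

  -- One step of SEI from 𝐱 (with S(𝐱) ≠ ∅): the distribution of 𝐱_{k+1},
  -- as (probability , 𝐱_{k+1}) pairs: choose x ∈ S(𝐱) with probability
  -- r(x)/r(S(𝐱)), then a uniformly random (min(B,|S(𝐱)|)-1)-subset of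
  -- S(𝐱) ∖ {x}.
  step : ℕ → List Tree → List (Carrier × List Tree)
  step B xs =
    concatMap
      (λ { (x , rest) →
           let us = choose (m ℕ.∸ 1) rest in
           map (λ u → (imp x / r* S) * (1# / fromℕ (length us)) , x ∷ u) us })
      (picks S)
    where
      S = S* xs
      m = B ℕ.⊓ length S

  -- The SEI loop with state (C , D , 𝐱_k); the fuel bounds the number of
  -- iterations (it is always taken ≥ the height, so it is never exhausted
  -- before S(𝐱_k) = ∅).
  run : ℕ → ℕ → Carrier → Carrier → List Tree → Dist
  run B zero C D xs = (1# , C) ∷ []
  run B (suc n) C D xs with S* xs
  ... | [] = (1# , C) ∷ []
  ... | _ ∷ _ =
    concatMap
      (λ { (p , ys) →
           let Dk = (∣ ys ∣ / ∣ xs ∣) * (r* (S* xs) / r* ys)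
               D′ = D * Dk
           in weight p (run B n (C + (c* ys / ∣ ys ∣) * D′) D′ ys) })
      (step B xs)

  CSEI : ℕ → List Tree → Dist
  CSEI B vs = run B (heightL vs) (c* vs / ∣ vs ∣) 1# vs

module Submission where

-- Let Y(𝐰) be the law of |𝐰| C_SEI(T_𝐰).  After its first step 𝐯 → 𝐮,
-- SEI continues as SEI started at 𝐮, rescaled: Y(𝐯) = c(𝐯) + ρ Y(𝐮) with
-- ρ = r(S(𝐯))/r(𝐮) (run-affine, Y-step).  The step reaches 𝐮 with total
-- probability r(𝐮) / (r(S(𝐯)) · N), N = (|S(𝐯)|-1 choose |𝐮|-1), but lists it
-- as x ∷ rest, so this regrouping (picks-choose) needs the conditional
-- moments to ignore the order of 𝐮; hence we first prove that every moment
-- of Y(𝐰) is invariant under reordering 𝐰 (perm-invariant, via choose-↭).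
-- Averaging over hyperchildren (ΣL-choose-ΣL) then gives mass 1 and
-- mean Cost(T_𝐰) (first-moments), and expanding E(c(𝐯) + ρ Y(𝐮))² gives
-- the variance formula (variance-fueled).

open import Defs
open import Level using (Level; _⊔_)
open import Data.Nat using (ℕ; _∸_)
open import Data.Nat as ℕ using (zero; suc; _⊓_)
import Data.Nat.Properties as ℕ
open import Data.Nat.Combinatorics using (_C_; nCk+nC[k+1]≡[n+1]C[k+1])
open import Data.Product using (_×_; _,_; proj₁; proj₂)
open import Data.Sum using (_⊎_; inj₁; inj₂)
open import Data.Maybe using (Maybe; just; nothing)
open import Data.Unit using (tt)
open import Data.Empty using (⊥-elim)
open import Data.List using (List; []; _∷_; _++_; map; concatMap; length)
import Data.List.Properties as List
open import Data.List.Relation.Unary.All as All using (All; []; _∷_)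
import Data.List.Relation.Unary.All.Properties as All
open import Data.List.Relation.Binary.Permutation.Propositional using (_↭_; ↭-sym; prep; swap) renaming (refl to ↭-refl; trans to ↭-trans)
import Data.List.Relation.Binary.Permutation.Propositional.Properties as ↭
open import Data.List.Relation.Binary.Sublist.Propositional using (_⊆_)
import Data.List.Relation.Binary.Sublist.Propositional.Properties as Sublist
open import Relation.Nullary using (¬_; yes; no)
open import Relation.Binary.PropositionalEquality as ≡ using (_≡_; _≢_)
open import Relation.Binary.Structures using (IsTotalOrder)
import Relation.Binary.Reasoning.Setoid as SetoidReasoning
open import Algebra.Bundles using (CommutativeRing; RawRing)
open import Algebra.Solver.Ring.AlmostCommutativeRing using (fromCommutativeRing; _-Raw-AlmostCommutative⟶_)
import Algebra.Solver.Ring as RingSolver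
import Algebra.Properties.Ring as RingProperties
import Algebra.Properties.AbelianGroup as AbelianGroupProperties
import Algebra.Properties.CommutativeSemigroup as CommutativeSemigroupProperties

module FieldFacts {c ℓ₁ ℓ₂} (F : OrderedField c ℓ₁ ℓ₂) where

  open OrderedField F

  commutativeRing : CommutativeRing c ℓ₁
  commutativeRing = record { isCommutativeRing = isCommutativeRing }

  open CommutativeRing commutativeRing public
    using ( refl; sym; trans; reflexive; setoid; ring
          ; +-cong; +-congˡ; +-congʳ; *-cong; *-congˡ; *-congʳ; -‿cong
          ; +-comm; +-assoc; *-comm; *-assoc; distribˡ; distribʳ
          ; +-identityˡ; +-identityʳ; *-identityˡ; *-identityʳ
          ; zeroˡ; zeroʳ; -‿inverseˡ; -‿inverseʳ)
  open RingProperties ring public using (-‿distribˡ-*; -‿distribʳ-*; -‿involutive; -0#≈0#)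
  open AbelianGroupProperties (CommutativeRing.+-abelianGroup commutativeRing) public using (⁻¹-∙-comm)
  open CommutativeSemigroupProperties (CommutativeRing.+-commutativeSemigroup commutativeRing) public using (interchange)
  open SetoidReasoning setoid

  fromℕ-+ : ∀ m n → fromℕ (m ℕ.+ n) ≈ fromℕ m + fromℕ n
  fromℕ-+ zero n = sym (+-identityˡ _)
  fromℕ-+ (suc m) n = trans (+-congˡ (fromℕ-+ m n)) (sym (+-assoc _ _ _))

  fromℕ-* : ∀ m n → fromℕ (m ℕ.* n) ≈ fromℕ m * fromℕ n
  fromℕ-* zero n = sym (zeroˡ _)
  fromℕ-* (suc m) n = begin
    fromℕ (n ℕ.+ m ℕ.* n)            ≈⟨ fromℕ-+ n (m ℕ.* n) ⟩
    fromℕ n + fromℕ (m ℕ.* n)        ≈⟨ +-cong (sym (*-identityˡ _)) (fromℕ-* m n) ⟩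
    1# * fromℕ n + fromℕ m * fromℕ n ≈⟨ distribʳ _ _ _ ⟨
    (1# + fromℕ m) * fromℕ n         ∎

  -- Its coefficients are integers, represented as pairs
  -- (a , b) standing for a - b; they map into the field by
  -- (a , b) ↦ fromℕ a - fromℕ b, and equality of coefficients is
  -- decided on the representatives (a + d ≡ c + b).
  private
    ℤ-pairs : RawRing Level.zero Level.zero
    ℤ-pairs = record
      { Carrier = ℕ × ℕ ; _≈_ = _≡_
      ; _+_ = λ { (a , b) (c , d) → a ℕ.+ c , b ℕ.+ d }
      ; _*_ = λ { (a , b) (c , d) → a ℕ.* c ℕ.+ b ℕ.* d , a ℕ.* d ℕ.+ b ℕ.* c }
      ; -_ = λ { (a , b) → b , a }
      ; 0# = 0 , 0 ; 1# = 1 , 0 }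

    ⟦_⟧ℤ : ℕ × ℕ → Carrier
    ⟦ a , b ⟧ℤ = fromℕ a - fromℕ b

    neg-+ : ∀ x y → - (x + y) ≈ - x + - y
    neg-+ x y = sym (⁻¹-∙-comm x y)

    ⟦⟧-+ : ∀ a b c d → ⟦ a ℕ.+ c , b ℕ.+ d ⟧ℤ ≈ ⟦ a , b ⟧ℤ + ⟦ c , d ⟧ℤ
    ⟦⟧-+ a b c d = begin
      fromℕ (a ℕ.+ c) - fromℕ (b ℕ.+ d)              ≈⟨ +-cong (fromℕ-+ a c) (-‿cong (fromℕ-+ b d)) ⟩
      (fromℕ a + fromℕ c) + - (fromℕ b + fromℕ d)    ≈⟨ +-congˡ (neg-+ _ _) ⟩
      (fromℕ a + fromℕ c) + (- fromℕ b + - fromℕ d)  ≈⟨ interchange _ _ _ _ ⟩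
      (fromℕ a - fromℕ b) + (fromℕ c - fromℕ d)      ∎

    ⟦⟧-neg : ∀ a b → ⟦ b , a ⟧ℤ ≈ - ⟦ a , b ⟧ℤ
    ⟦⟧-neg a b = begin
      fromℕ b + - fromℕ a     ≈⟨ +-comm _ _ ⟩
      - fromℕ a + fromℕ b     ≈⟨ +-congˡ (-‿involutive _) ⟨
      - fromℕ a + - - fromℕ b ≈⟨ neg-+ _ _ ⟨
      - (fromℕ a - fromℕ b)   ∎

    ⟦⟧-* : ∀ a b c d → ⟦ a ℕ.* c ℕ.+ b ℕ.* d , a ℕ.* d ℕ.+ b ℕ.* c ⟧ℤ ≈ ⟦ a , b ⟧ℤ * ⟦ c , d ⟧ℤ
    ⟦⟧-* a b c d = begin
      ⟦ a ℕ.* c ℕ.+ b ℕ.* d , a ℕ.* d ℕ.+ b ℕ.* c ⟧ℤ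
        ≈⟨ +-cong (trans (fromℕ-+ (a ℕ.* c) (b ℕ.* d)) (+-cong (fromℕ-* a c) (fromℕ-* b d)))
                  (-‿cong (trans (fromℕ-+ (a ℕ.* d) (b ℕ.* c)) (+-cong (fromℕ-* a d) (fromℕ-* b c)))) ⟩
      (A * C + B * D) + - (A * D + B * C)        ≈⟨ +-congˡ (neg-+ _ _) ⟩
      (A * C + B * D) + (- (A * D) + - (B * C))  ≈⟨ interchange _ _ _ _ ⟩
      (A * C + - (A * D)) + (B * D + - (B * C))  ≈⟨ +-congˡ (+-comm _ _) ⟩
      (A * C + - (A * D)) + (- (B * C) + B * D)
        ≈⟨ +-cong (+-congˡ (-‿distribʳ-* _ _))
                  (+-cong (-‿distribˡ-* _ _) (trans (sym (-‿involutive _)) (trans (-‿cong (-‿distribʳ-* B D)) (-‿distribˡ-* B (- D))))) ⟩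
      (A * C + A * - D) + (- B * C + - B * - D)  ≈⟨ +-cong (distribˡ _ _ _) (distribˡ _ _ _) ⟨
      A * (C - D) + - B * (C - D)                ≈⟨ distribʳ _ _ _ ⟨
      (A - B) * (C - D)                          ∎
      where A = fromℕ a ; B = fromℕ b ; C = fromℕ c ; D = fromℕ d

    ⟦⟧-hom : ℤ-pairs -Raw-AlmostCommutative⟶ fromCommutativeRing commutativeRing
    ⟦⟧-hom = record
      { ⟦_⟧ = ⟦_⟧ℤ
      ; +-homo = λ { (a , b) (c , d) → ⟦⟧-+ a b c d }
      ; *-homo = λ { (a , b) (c , d) → ⟦⟧-* a b c d }
      ; -‿homo = λ { (a , b) → ⟦⟧-neg a b }
      ; 0-homo = trans (+-congˡ -0#≈0#) (+-identityʳ _)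
      ; 1-homo = trans (+-congˡ -0#≈0#) (trans (+-identityʳ _) (+-identityʳ _))
      }

    ⟦⟧-dec : ∀ x y → Maybe (⟦ x ⟧ℤ ≈ ⟦ y ⟧ℤ)
    ⟦⟧-dec (a , b) (c , d) with a ℕ.+ d ℕ.≟ c ℕ.+ b
    ... | no _ = nothing
    ... | yes a+d≡c+b = just (begin
      A - B                ≈⟨ +-identityʳ _ ⟨
      (A - B) + 0#         ≈⟨ +-congˡ (-‿inverseʳ D) ⟨
      (A - B) + (D - D)    ≈⟨ interchange _ _ _ _ ⟩
      (A + D) + (- B - D)  ≈⟨ +-congʳ (trans (sym (fromℕ-+ a d)) (trans (reflexive (≡.cong fromℕ a+d≡c+b)) (fromℕ-+ c b))) ⟩
      (C + B) + (- B - D)  ≈⟨ interchange _ _ _ _ ⟩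
      (C - B) + (B - D)    ≈⟨ +-congʳ (+-comm _ _) ⟩
      (- B + C) + (B - D)  ≈⟨ interchange _ _ _ _ ⟩
      (- B + B) + (C - D)  ≈⟨ +-congʳ (-‿inverseˡ B) ⟩
      0# + (C - D)         ≈⟨ +-identityˡ _ ⟩
      C - D                ∎)
      where A = fromℕ a ; B = fromℕ b ; C = fromℕ c ; D = fromℕ d

  open RingSolver ℤ-pairs (fromCommutativeRing commutativeRing) ⟦⟧-hom ⟦⟧-dec public
    using (solve; _:=_; _:+_; _:*_; :-_; _:-_)

  *-/-cancel : ∀ {x} y → ¬ (x ≈ 0#) → x * (y / x) ≈ y
  *-/-cancel {x} y x≉0 =
    trans (solve 3 (λ x y x⁻¹ → x :* (y :* x⁻¹) := y :* (x :* x⁻¹)) refl x y (x ⁻¹))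
          (trans (*-congˡ (⁻¹-inverse x x≉0)) (*-identityʳ y))

  open IsTotalOrder isTotalOrder public using (total; antisym) renaming (reflexive to ≤-reflexive; trans to ≤-trans)

  ≤-respʳ-≈ : ∀ {x y z} → x ≤ y → y ≈ z → x ≤ z
  ≤-respʳ-≈ p e = ≤-trans p (≤-reflexive e)

  ≤-respˡ-≈ : ∀ {x y z} → x ≈ y → y ≤ z → x ≤ z
  ≤-respˡ-≈ e p = ≤-trans (≤-reflexive e) p

  -- 1 > 0 (since 1 = (-1)(-1) would otherwise be ≤ 0), hence fromℕ (suc n) > 0.
  0≤1 : 0# ≤ 1#
  0≤1 with total 0# 1#
  ... | inj₁ 0≤1 = 0≤1
  ... | inj₂ 1≤0 = ⊥-elim (0≉1 (sym (antisym 1≤0 (≤-respʳ-≈ (*-nonneg 0≤-1 0≤-1) -1*-1≈1))))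
    where
    0≤-1 : 0# ≤ - 1#
    0≤-1 = ≤-respˡ-≈ (sym (-‿inverseʳ 1#)) (≤-respʳ-≈ (+-monoˡ-≤ (- 1#) 1≤0) (+-identityˡ _))
    -1*-1≈1 : - 1# * - 1# ≈ 1#
    -1*-1≈1 = trans (solve 1 (λ x → :- x :* :- x := x :* x) refl 1#) (*-identityˡ 1#)

  0≤+ : ∀ {a b} → 0# ≤ a → 0# ≤ b → 0# ≤ a + b
  0≤+ {a} {b} 0≤a 0≤b = ≤-trans 0≤b (≤-respˡ-≈ (sym (+-identityˡ b)) (+-monoˡ-≤ b 0≤a))

  0<+ : ∀ {a b} → 0# < a → 0# ≤ b → 0# < a + b
  0<+ {a} {b} (0≤a , 0≉a) 0≤b = 0≤+ 0≤a 0≤b , λ 0≈a+b → 0≉a (antisym 0≤a (≤-respʳ-≈ a≤a+b (sym 0≈a+b)))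
    where
    a≤a+b : a ≤ a + b
    a≤a+b = ≤-respˡ-≈ (sym (+-identityˡ a)) (≤-respʳ-≈ (+-monoˡ-≤ a 0≤b) (+-comm b a))

  <⇒≉0 : ∀ {x} → 0# < x → ¬ (x ≈ 0#)
  <⇒≉0 (_ , 0≉x) x≈0 = 0≉x (sym x≈0)

  fromℕ-nonneg : ∀ n → 0# ≤ fromℕ n
  fromℕ-nonneg zero = ≤-reflexive refl
  fromℕ-nonneg (suc n) = 0≤+ 0≤1 (fromℕ-nonneg n)

  fromℕ-suc≉0 : ∀ n → ¬ (fromℕ (suc n) ≈ 0#)
  fromℕ-suc≉0 n = <⇒≉0 (0<+ (0≤1 , 0≉1) (fromℕ-nonneg n))

  fromℕ≉0 : ∀ {n} → 1 ℕ.≤ n → ¬ (fromℕ n ≈ 0#)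
  fromℕ≉0 {suc n} _ = fromℕ-suc≉0 n

module FiniteSums {c ℓ₁ ℓ₂} (F : OrderedField c ℓ₁ ℓ₂) where

  open OrderedField F
  open FieldFacts F

  ΣL : ∀ {a} {A : Set a} → (A → Carrier) → List A → Carrier
  ΣL f [] = 0#
  ΣL f (x ∷ xs) = f x + ΣL f xs

  Σ-map : ∀ {a} {A : Set a} (f : A → Carrier) xs → Σ (map f xs) ≡ ΣL f xs
  Σ-map f [] = ≡.refl
  Σ-map f (x ∷ xs) = ≡.cong (f x +_) (Σ-map f xs)

  ΣL-++ : ∀ {a} {A : Set a} (f : A → Carrier) xs ys → ΣL f (xs ++ ys) ≈ ΣL f xs + ΣL f ys
  ΣL-++ f [] ys = sym (+-identityˡ _)
  ΣL-++ f (x ∷ xs) ys = trans (+-congˡ (ΣL-++ f xs ys)) (sym (+-assoc _ _ _))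

  ΣL-cong : ∀ {a} {A : Set a} {f g : A → Carrier} → (∀ x → f x ≈ g x) → ∀ xs → ΣL f xs ≈ ΣL g xs
  ΣL-cong f≈g [] = refl
  ΣL-cong f≈g (x ∷ xs) = +-cong (f≈g x) (ΣL-cong f≈g xs)

  ΣL-congᴬ : ∀ {a} {A : Set a} {f g : A → Carrier} {xs} → All (λ x → f x ≈ g x) xs → ΣL f xs ≈ ΣL g xs
  ΣL-congᴬ [] = refl
  ΣL-congᴬ (e ∷ es) = +-cong e (ΣL-congᴬ es)

  ΣL-map : ∀ {a b} {A : Set a} {B : Set b} (f : B → Carrier) (g : A → B) xs → ΣL f (map g xs) ≡ ΣL (λ x → f (g x)) xs
  ΣL-map f g [] = ≡.refl
  ΣL-map f g (x ∷ xs) = ≡.cong (f (g x) +_) (ΣL-map f g xs)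

  ΣL-concatMap : ∀ {a b} {A : Set a} {B : Set b} (f : B → Carrier) (g : A → List B) xs →
                 ΣL f (concatMap g xs) ≈ ΣL (λ x → ΣL f (g x)) xs
  ΣL-concatMap f g [] = refl
  ΣL-concatMap f g (x ∷ xs) = trans (ΣL-++ f (g x) (concatMap g xs)) (+-congˡ (ΣL-concatMap f g xs))

  ΣL-+ : ∀ {a} {A : Set a} (f g : A → Carrier) xs → ΣL (λ x → f x + g x) xs ≈ ΣL f xs + ΣL g xs
  ΣL-+ f g [] = sym (+-identityˡ _)
  ΣL-+ f g (x ∷ xs) = trans (+-congˡ (ΣL-+ f g xs)) (interchange _ _ _ _)

  ΣL-*ˡ : ∀ {a} {A : Set a} (k : Carrier) (f : A → Carrier) xs → ΣL (λ x → k * f x) xs ≈ k * ΣL f xs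
  ΣL-*ˡ k f [] = sym (zeroʳ _)
  ΣL-*ˡ k f (x ∷ xs) = trans (+-congˡ (ΣL-*ˡ k f xs)) (sym (distribˡ _ _ _))

  ΣL-const : ∀ {a} {A : Set a} (k : Carrier) (xs : List A) → ΣL (λ _ → k) xs ≈ fromℕ (length xs) * k
  ΣL-const k [] = sym (zeroˡ _)
  ΣL-const k (x ∷ xs) = trans (+-cong (sym (*-identityˡ k)) (ΣL-const k xs)) (sym (distribʳ _ _ _))

  ΣL-↭ : ∀ {a} {A : Set a} (f : A → Carrier) {xs ys} → xs ↭ ys → ΣL f xs ≈ ΣL f ys
  ΣL-↭ f ↭-refl = refl
  ΣL-↭ f (prep x p) = +-congˡ (ΣL-↭ f p)
  ΣL-↭ f (swap x y p) =
    trans (sym (+-assoc _ _ _)) (trans (+-congʳ (+-comm _ _)) (trans (+-assoc _ _ _) (+-congˡ (+-congˡ (ΣL-↭ f p)))))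
  ΣL-↭ f (↭-trans p q) = trans (ΣL-↭ f p) (ΣL-↭ f q)

  ΣL-nonneg : ∀ {a} {A : Set a} (f : A → Carrier) {xs} → All (λ x → 0# ≤ f x) xs → 0# ≤ ΣL f xs
  ΣL-nonneg f [] = ≤-reflexive refl
  ΣL-nonneg f (p ∷ ps) = 0≤+ p (ΣL-nonneg f ps)

module Moments {c ℓ₁ ℓ₂} (F : OrderedField c ℓ₁ ℓ₂) where

  open OrderedField F
  open SEI F using (Dist; E; Var; weight; scaleBy)
  open FieldFacts F
  open FiniteSums F

  moment : (Carrier → Carrier) → Dist → Carrier
  moment φ = ΣL (λ px → proj₁ px * φ (proj₂ px))

  sq : Carrier → Carrier
  sq x = x * x

  mass mean second : Dist → Carrier
  mass = moment (λ _ → 1#)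
  mean = moment (λ x → x)
  second = moment sq

  Congruent : (Carrier → Carrier) → Set _
  Congruent φ = ∀ {x y} → x ≈ y → φ x ≈ φ y

  sq-cong : Congruent sq
  sq-cong x≈y = *-cong x≈y x≈y

  E≡mean : ∀ d → E d ≡ mean d
  E≡mean [] = ≡.refl
  E≡mean ((p , x) ∷ d) = ≡.cong (p * x +_) (E≡mean d)

  E-squares≡second : ∀ d → E (map (λ { (p , x) → p , x * x }) d) ≡ second d
  E-squares≡second [] = ≡.refl
  E-squares≡second ((p , x) ∷ d) = ≡.cong (p * (x * x) +_) (E-squares≡second d)

  Var≡ : ∀ d → Var d ≡ second d - mean d * mean d
  Var≡ d = ≡.cong₂ (λ s m → s - m * m) (E-squares≡second d) (E≡mean d)

  moment-congφ : ∀ {φ ψ} → (∀ x → φ x ≈ ψ x) → ∀ d → moment φ d ≈ moment ψ d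
  moment-congφ φ≈ψ = ΣL-cong (λ px → *-congˡ (φ≈ψ (proj₂ px)))

  moment-concatMap : ∀ {a} {A : Set a} φ (g : A → Dist) xs → moment φ (concatMap g xs) ≈ ΣL (λ x → moment φ (g x)) xs
  moment-concatMap φ g xs = ΣL-concatMap _ g xs

  moment-weight : ∀ φ q d → moment φ (weight q d) ≈ q * moment φ d
  moment-weight φ q [] = sym (zeroʳ _)
  moment-weight φ q ((p , x) ∷ d) = trans (+-cong (*-assoc _ _ _) (moment-weight φ q d)) (sym (distribˡ _ _ _))

  moment-scaleBy : ∀ φ a d → moment φ (scaleBy a d) ≡ moment (λ x → φ (a * x)) d
  moment-scaleBy φ a [] = ≡.refl
  moment-scaleBy φ a ((p , x) ∷ d) = ≡.cong (p * φ (a * x) +_) (moment-scaleBy φ a d)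

  moment-+ : ∀ φ ψ d → moment (λ x → φ x + ψ x) d ≈ moment φ d + moment ψ d
  moment-+ φ ψ d = trans (ΣL-cong (λ px → distribˡ _ _ _) d) (ΣL-+ _ _ d)

  moment-*ˡ : ∀ k φ d → moment (λ x → k * φ x) d ≈ k * moment φ d
  moment-*ˡ k φ d = trans (ΣL-cong (λ px → x∙yz≈y∙xz _ _ _) d) (ΣL-*ˡ k _ d)
    where
    x∙yz≈y∙xz : ∀ a b d → a * (b * d) ≈ b * (a * d)
    x∙yz≈y∙xz = solve 3 (λ a b d → a :* (b :* d) := b :* (a :* d)) refl

  moment-affine : ∀ a b d → moment (λ z → a + b * z) d ≈ a * mass d + b * mean d
  moment-affine a b d = trans (moment-congφ (λ z → +-congʳ (sym (*-identityʳ a))) d)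
    (trans (moment-+ (λ _ → a * 1#) (λ z → b * z) d) (+-cong (moment-*ˡ a (λ _ → 1#) d) (moment-*ˡ b (λ z → z) d)))

  moment-quadratic : ∀ a b d →
    moment (λ z → sq (a + b * z)) d ≈ (a * a) * mass d + ((a + a) * b) * mean d + (b * b) * second d
  moment-quadratic a b d = trans (moment-congφ (λ z → trans (expand a b z) (+-congʳ (+-congʳ (sym (*-identityʳ _))))) d)
    (trans (moment-+ _ _ d)
      (+-cong (trans (moment-+ _ _ d) (+-cong (moment-*ˡ (a * a) (λ _ → 1#) d) (moment-*ˡ ((a + a) * b) (λ z → z) d)))
              (moment-*ˡ (b * b) sq d)))
    where
    expand : ∀ a b z → sq (a + b * z) ≈ a * a + ((a + a) * b) * z + (b * b) * (z * z)
    expand = solve 3 (λ a b z → (a :+ b :* z) :* (a :+ b :* z)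
                                := a :* a :+ ((a :+ a) :* b) :* z :+ (b :* b) :* (z :* z)) refl

module Subsets {c ℓ₁ ℓ₂} (F : OrderedField c ℓ₁ ℓ₂) {A : Set c} where

  open OrderedField F
  open SEI F using (choose; picks)
  open FieldFacts F
  open FiniteSums F
  open SetoidReasoning setoid

  All-choose : ∀ {p} {P : A → Set p} k xs → All P xs → All (λ u → All P u × (length u ≡ k)) (choose k xs)
  All-choose zero xs Pxs = ([] , ≡.refl) ∷ []
  All-choose (suc k) [] Pxs = []
  All-choose (suc k) (x ∷ xs) (Px ∷ Pxs) =
    All.++⁺ (All.map⁺ (All.map (λ { (Pu , ∣u∣≡k) → Px ∷ Pu , ≡.cong suc ∣u∣≡k }) (All-choose k xs Pxs)))
            (All-choose (suc k) xs Pxs)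

  All-picks : ∀ {p} {P : A → Set p} xs → All P xs →
    All (λ xr → P (proj₁ xr) × All P (proj₂ xr) × (suc (length (proj₂ xr)) ≡ length xs)) (picks xs)
  All-picks [] [] = []
  All-picks (y ∷ xs) (Py ∷ Pxs) =
    (Py , Pxs , ≡.refl)
    ∷ All.map⁺ (All.map (λ { (Px , Prest , len) → Px , Py ∷ Prest , ≡.cong suc len }) (All-picks xs Pxs))

  length-choose : ∀ k (xs : List A) → length (choose k xs) ≡ length xs C k
  length-choose zero xs = ≡.refl
  length-choose (suc k) [] = ≡.refl
  length-choose (suc k) (x ∷ xs) =
    ≡.trans (List.length-++ (map (x ∷_) (choose k xs)))
      (≡.trans (≡.cong₂ ℕ._+_ (≡.trans (List.length-map (x ∷_) (choose k xs)) (length-choose k xs))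
                              (length-choose (suc k) xs))
               (nCk+nC[k+1]≡[n+1]C[k+1] (length xs) k))

  choose-split : ∀ (h : List A → Carrier) k x xs →
    ΣL h (choose (suc k) (x ∷ xs)) ≈ ΣL (λ u → h (x ∷ u)) (choose k xs) + ΣL h (choose (suc k) xs)
  choose-split h k x xs = trans (ΣL-++ h (map (x ∷_) (choose k xs)) _) (+-congʳ (reflexive (ΣL-map h (x ∷_) (choose k xs))))

  -- Every x ∈ xs lies in exactly (|xs|-1 choose k) of the (k+1)-subsets of
  -- xs, hence summing ∑_{t ∈ u} f t over all (k+1)-subsets u of xs counts
  -- each f x that many times.
  ΣL-choose-ΣL : ∀ (f : A → Carrier) k xs →
    ΣL (ΣL f) (choose (suc k) xs) ≈ fromℕ ((length xs ∸ 1) C k) * ΣL f xs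
  ΣL-choose-ΣL f k [] = sym (zeroʳ _)
  ΣL-choose-ΣL f zero (x ∷ xs) = begin
    (f x + 0#) + ΣL (ΣL f) (choose 1 xs)         ≈⟨ +-cong (+-identityʳ _) (ΣL-choose-ΣL f zero xs) ⟩
    f x + fromℕ ((length xs ∸ 1) C 0) * ΣL f xs  ≈⟨ +-cong (sym (*-identityˡ _)) (*-congʳ (+-identityʳ 1#)) ⟩
    1# * f x + 1# * ΣL f xs                      ≈⟨ distribˡ _ _ _ ⟨
    1# * (f x + ΣL f xs)                         ≈⟨ *-congʳ (+-identityʳ 1#) ⟨
    fromℕ (length xs C 0) * ΣL f (x ∷ xs)        ∎
  ΣL-choose-ΣL f (suc k) (x ∷ xs) = begin
    ΣL (ΣL f) (choose (suc (suc k)) (x ∷ xs))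
      ≈⟨ choose-split (ΣL f) (suc k) x xs ⟩
    ΣL (λ u → f x + ΣL f u) (choose (suc k) xs) + ΣL (ΣL f) (choose (suc (suc k)) xs)
      ≈⟨ +-cong (ΣL-+ (λ _ → f x) (ΣL f) (choose (suc k) xs)) (ΣL-choose-ΣL f (suc k) xs) ⟩
    (ΣL (λ _ → f x) (choose (suc k) xs) + ΣL (ΣL f) (choose (suc k) xs)) + fromℕ (n-1 C suc k) * ΣL f xs
      ≈⟨ +-congʳ (+-cong (trans (ΣL-const (f x) (choose (suc k) xs)) (*-congʳ (reflexive (≡.cong fromℕ (length-choose (suc k) xs)))))
                         (ΣL-choose-ΣL f k xs)) ⟩
    (fromℕ (n C suc k) * f x + fromℕ (n-1 C k) * ΣL f xs) + fromℕ (n-1 C suc k) * ΣL f xs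
      ≈⟨ trans (+-assoc _ _ _) (+-congˡ (sym (distribʳ _ _ _))) ⟩
    fromℕ (n C suc k) * f x + (fromℕ (n-1 C k) + fromℕ (n-1 C suc k)) * ΣL f xs
      ≈⟨ +-congˡ (pascal xs) ⟩
    fromℕ (n C suc k) * f x + fromℕ (n C suc k) * ΣL f xs
      ≈⟨ distribˡ _ _ _ ⟨
    fromℕ (n C suc k) * ΣL f (x ∷ xs) ∎
    where
    n = length xs
    n-1 = length xs ∸ 1
    -- Pascal's rule, trivially true when xs = [] since the sum vanishes
    pascal : ∀ ys → (fromℕ ((length ys ∸ 1) C k) + fromℕ ((length ys ∸ 1) C suc k)) * ΣL f ys
                    ≈ fromℕ (length ys C suc k) * ΣL f ys
    pascal [] = trans (zeroʳ _) (sym (zeroʳ _))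
    pascal (y ∷ ys) = *-congʳ (trans (sym (fromℕ-+ (length ys C k) (length ys C suc k)))
                                     (reflexive (≡.cong fromℕ (nCk+nC[k+1]≡[n+1]C[k+1] (length ys) k))))

  Symmetric : ∀ {p} → (A → Set p) → (List A → Carrier) → Set _
  Symmetric P g = ∀ {u u′} → All P u → u ↭ u′ → g u ≈ g u′

  Symmetric-∷ : ∀ {p} {P : A → Set p} {g} y → P y → Symmetric P g → Symmetric P (λ u → g (y ∷ u))
  Symmetric-∷ y Py sym-g Pu u↭u′ = sym-g (Py ∷ Pu) (prep y u↭u′)

  -- Choosing an element x of S and then k further elements of the rest
  -- reaches every (k+1)-subset w of S once through each of its elements;
  -- for symmetric g the weights r x of these ways add up to r(w).
  picked : (A → Carrier) → ℕ → (List A → Carrier) → A × List A → Carrier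
  picked r k g (x , rest) = ΣL (λ u → r x * g (x ∷ u)) (choose k rest)

  picks-choose : ∀ {p} {P : A → Set p} (r : A → Carrier) k S (g : List A → Carrier) → All P S → Symmetric P g →
    ΣL (picked r k g) (picks S) ≈ ΣL (λ w → ΣL r w * g w) (choose (suc k) S)
  picks-choose r k [] g PS sym-g = refl
  picks-choose r zero (y ∷ S) g (Py ∷ PS) sym-g =
    +-cong (trans (+-identityʳ _) (*-congʳ (sym (+-identityʳ _))))
           (trans (reflexive (ΣL-map _ (λ { (z , zs) → z , y ∷ zs }) (picks S))) (picks-choose r zero S g PS sym-g))
  picks-choose {P = P} r (suc k) (y ∷ S) g (Py ∷ PS) sym-g = begin
    picked r (suc k) g (y , S) + ΣL (picked r (suc k) g) (map shift (picks S))
      ≈⟨ +-congˡ (trans (reflexive (ΣL-map _ shift (picks S))) (ΣL-congᴬ (All.map shifted (All-picks S PS)))) ⟩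
    picked r (suc k) g (y , S) + ΣL (λ xr → picked r k g′ xr + picked r (suc k) g xr) (picks S)
      ≈⟨ +-congˡ (trans (ΣL-+ _ _ (picks S)) (+-cong (picks-choose r k S g′ PS (Symmetric-∷ y Py sym-g))
                                                      (picks-choose r (suc k) S g PS sym-g))) ⟩
    ΣL (λ u → r y * g′ u) (choose (suc k) S) + (ΣL (λ w → ΣL r w * g′ w) (choose (suc k) S) + without-y)
      ≈⟨ +-assoc _ _ _ ⟨
    (ΣL (λ u → r y * g′ u) (choose (suc k) S) + ΣL (λ w → ΣL r w * g′ w) (choose (suc k) S)) + without-y
      ≈⟨ +-congʳ (trans (ΣL-cong (λ u → distribʳ _ _ _) (choose (suc k) S)) (ΣL-+ _ _ (choose (suc k) S))) ⟨
    ΣL (λ u → ΣL r (y ∷ u) * g (y ∷ u)) (choose (suc k) S) + without-y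
      ≈⟨ choose-split (λ w → ΣL r w * g w) (suc k) y S ⟨
    ΣL (λ w → ΣL r w * g w) (choose (suc (suc k)) (y ∷ S)) ∎
    where
    shift : A × List A → A × List A
    shift (z , zs) = z , y ∷ zs
    g′ : List A → Carrier
    g′ u = g (y ∷ u)
    without-y = ΣL (λ w → ΣL r w * g w) (choose (suc (suc k)) S)
    -- completions of a pick (x , y ∷ rest) that contain y, and those that do not
    shifted : ∀ {xr} → P (proj₁ xr) × All P (proj₂ xr) × _ →
              picked r (suc k) g (shift xr) ≈ picked r k g′ xr + picked r (suc k) g xr
    shifted {x , rest} (Px , Prest , _) = trans (choose-split (λ u → r x * g (x ∷ u)) k y rest)
      (+-congʳ (ΣL-congᴬ (All.map (λ { (Pu , _) → *-congˡ (sym-g (Px ∷ Py ∷ Pu) (swap x y ↭-refl)) })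
                                  (All-choose k rest Prest))))

  choose-split₂ : ∀ (h : List A → Carrier) k x y xs →
    ΣL h (choose (suc (suc k)) (x ∷ y ∷ xs))
      ≈ (ΣL (λ u → h (x ∷ y ∷ u)) (choose k xs) + ΣL (λ u → h (x ∷ u)) (choose (suc k) xs))
        + (ΣL (λ u → h (y ∷ u)) (choose (suc k) xs) + ΣL h (choose (suc (suc k)) xs))
  choose-split₂ h k x y xs =
    trans (choose-split h (suc k) x (y ∷ xs)) (+-cong (choose-split (λ u → h (x ∷ u)) k y xs) (choose-split h (suc k) y xs))

  choose-↭ : ∀ {p} {P : A → Set p} k (h : List A → Carrier) {xs ys} → All P xs → Symmetric P h → xs ↭ ys →
    ΣL h (choose k xs) ≈ ΣL h (choose k ys)
  choose-↭ k h Pxs sym-h ↭-refl = refl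
  choose-↭ zero h Pxs sym-h (prep x p) = refl
  choose-↭ (suc k) h {x ∷ xs} {.x ∷ ys} (Px ∷ Pxs) sym-h (prep x p) =
    trans (choose-split h k x xs)
      (trans (+-cong (choose-↭ k (λ u → h (x ∷ u)) Pxs (Symmetric-∷ x Px sym-h) p) (choose-↭ (suc k) h Pxs sym-h p))
             (sym (choose-split h k x ys)))
  choose-↭ zero h Pxs sym-h (swap x y p) = refl
  choose-↭ (suc zero) h (Px ∷ Py ∷ Pxs) sym-h (swap x y p) =
    trans (sym (+-assoc _ _ _)) (trans (+-congʳ (+-comm _ _)) (trans (+-assoc _ _ _) (+-congˡ (+-congˡ (choose-↭ 1 h Pxs sym-h p)))))
  choose-↭ (suc (suc k)) h {x ∷ y ∷ xs} {.y ∷ .x ∷ ys} (Px ∷ Py ∷ Pxs) sym-h (swap x y p) = begin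
    ΣL h (choose (suc (suc k)) (x ∷ y ∷ xs))
      ≈⟨ choose-split₂ h k x y xs ⟩
    (ΣL (λ u → h (x ∷ y ∷ u)) (choose k xs) + ΣL (λ u → h (x ∷ u)) (choose (suc k) xs))
      + (ΣL (λ u → h (y ∷ u)) (choose (suc k) xs) + ΣL h (choose (suc (suc k)) xs))
      ≈⟨ +-cong (+-cong (trans (ΣL-congᴬ (All.map (λ { (Pu , _) → sym-h (Px ∷ Py ∷ Pu) (swap x y ↭-refl) }) (All-choose k xs Pxs)))
                               (choose-↭ k (λ u → h (y ∷ x ∷ u)) Pxs (Symmetric-∷ x Px (Symmetric-∷ y Py sym-h)) p))
                        (choose-↭ (suc k) (λ u → h (x ∷ u)) Pxs (Symmetric-∷ x Px sym-h) p))
                (+-cong (choose-↭ (suc k) (λ u → h (y ∷ u)) Pxs (Symmetric-∷ y Py sym-h) p)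
                        (choose-↭ (suc (suc k)) h Pxs sym-h p)) ⟩
    (ΣL (λ u → h (y ∷ x ∷ u)) (choose k ys) + ΣL (λ u → h (x ∷ u)) (choose (suc k) ys))
      + (ΣL (λ u → h (y ∷ u)) (choose (suc k) ys) + ΣL h (choose (suc (suc k)) ys))
      ≈⟨ interchange _ _ _ _ ⟩
    (ΣL (λ u → h (y ∷ x ∷ u)) (choose k ys) + ΣL (λ u → h (y ∷ u)) (choose (suc k) ys))
      + (ΣL (λ u → h (x ∷ u)) (choose (suc k) ys) + ΣL h (choose (suc (suc k)) ys))
      ≈⟨ choose-split₂ h k y x ys ⟨
    ΣL h (choose (suc (suc k)) (y ∷ x ∷ ys)) ∎
  choose-↭ k h Pxs sym-h (↭-trans p q) = trans (choose-↭ k h Pxs sym-h p) (choose-↭ k h (↭.All-resp-↭ p Pxs) sym-h q)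

module Trees {c ℓ₁ ℓ₂} (F : OrderedField c ℓ₁ ℓ₂) where

  open OrderedField F
  open SEI F
  open FieldFacts F
  open FiniteSums F
  open SetoidReasoning setoid

  Costs≡ΣL : ∀ ts → Costs ts ≡ ΣL Cost ts
  Costs≡ΣL [] = ≡.refl
  Costs≡ΣL (t ∷ ts) = ≡.cong (Cost t +_) (Costs≡ΣL ts)

  Cost*-split : ∀ w → Cost* w ≈ c* w + Cost* (S* w)
  Cost*-split [] = sym (+-identityˡ _)
  Cost*-split (node x y ts ∷ w) = begin
    (x + Costs ts) + Costs w                ≈⟨ +-congˡ (Cost*-split w) ⟩
    (x + Costs ts) + (c* w + Costs (S* w))  ≈⟨ interchange _ _ _ _ ⟩
    (x + c* w) + (Costs ts + Costs (S* w))  ≈⟨ +-congˡ Costs-++ ⟨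
    (x + c* w) + Costs (ts ++ S* w)         ∎
    where
    Costs-++ : Costs (ts ++ S* w) ≈ Costs ts + Costs (S* w)
    Costs-++ = trans (reflexive (Costs≡ΣL (ts ++ S* w)))
                 (trans (ΣL-++ Cost ts (S* w)) (reflexive (≡.sym (≡.cong₂ _+_ (Costs≡ΣL ts) (Costs≡ΣL (S* w))))))

  S*-↭ : ∀ {w w′} → w ↭ w′ → S* w ↭ S* w′
  S*-↭ ↭-refl = ↭-refl
  S*-↭ (prep x p) = ↭.++⁺ˡ (kids x) (S*-↭ p)
  S*-↭ (swap x y p) = ↭-trans (↭.shifts (kids x) (kids y)) (↭.++⁺ˡ (kids y) (↭.++⁺ˡ (kids x) (S*-↭ p)))
  S*-↭ (↭-trans p q) = ↭-trans (S*-↭ p) (S*-↭ q)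

  r*-↭ : ∀ {w w′} → w ↭ w′ → r* w ≈ r* w′
  r*-↭ {w} {w′} p = trans (reflexive (Σ-map imp w)) (trans (ΣL-↭ imp p) (reflexive (≡.sym (Σ-map imp w′))))

  c*-↭ : ∀ {w w′} → w ↭ w′ → c* w ≈ c* w′
  c*-↭ {w} {w′} p = trans (reflexive (Σ-map cst w)) (trans (ΣL-↭ cst p) (reflexive (≡.sym (Σ-map cst w′))))

  data Good : Tree → Set (c ⊔ ℓ₁ ⊔ ℓ₂) where
    good : ∀ {x y ts} → 0# < y → All Good ts → Good (node x y ts)

  mutual
    good-nodes : ∀ t → All (λ u → (0# ≤ cst u) × (0# < imp u)) (nodes t) → Good t
    good-nodes (node x y ts) ((_ , 0<y) ∷ ps) = good 0<y (good-nodesL ts ps)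

    good-nodesL : ∀ ts → All (λ u → (0# ≤ cst u) × (0# < imp u)) (nodesL ts) → All Good ts
    good-nodesL [] ps = []
    good-nodesL (t ∷ ts) ps = good-nodes t (All.++⁻ˡ (nodes t) ps) ∷ good-nodesL ts (All.++⁻ʳ (nodes t) ps)

  mutual
    good-level : ∀ d t → Good t → All Good (level d t)
    good-level zero t g = g ∷ []
    good-level (suc d) (node x y ts) (good _ gs) = good-levelL d ts gs

    good-levelL : ∀ d ts → All Good ts → All Good (levelL d ts)
    good-levelL d [] [] = []
    good-levelL d (t ∷ ts) (g ∷ gs) = All.++⁺ (good-level d t g) (good-levelL d ts gs)

  r*≉0 : ∀ {w} → All Good w → w ≢ [] → ¬ (r* w ≈ 0#)
  r*≉0 [] w≢[] = ⊥-elim (w≢[] ≡.refl)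
  r*≉0 {t ∷ w} (good 0<r _ ∷ gs) _ =
    <⇒≉0 (0<+ 0<r (≤-respʳ-≈ (ΣL-nonneg imp (All.map (λ { (good 0<r′ _) → proj₁ 0<r′ }) gs)) (reflexive (≡.sym (Σ-map imp w)))))

  ∣∣≉0 : ∀ {w : List Tree} → w ≢ [] → ¬ (∣ w ∣ ≈ 0#)
  ∣∣≉0 {[]} w≢[] = ⊥-elim (w≢[] ≡.refl)
  ∣∣≉0 {t ∷ w} _ = fromℕ-suc≉0 (length w)

  S*≢[]⇒≢[] : ∀ {w} → S* w ≢ [] → w ≢ []
  S*≢[]⇒≢[] S*w≢[] ≡.refl = S*w≢[] ≡.refl

  -- A good tree of height at most n: SEI run with fuel n from a hypernode
  -- of such trees never runs out of fuel.
  Fueled : ℕ → Tree → Set (c ⊔ ℓ₁ ⊔ ℓ₂)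
  Fueled n t = Good t × (height t ℕ.≤ n)

  Fueled-S* : ∀ {n w} → All (Fueled (suc n)) w → All (Fueled n) (S* w)
  Fueled-S* [] = []
  Fueled-S* {n} ((good {ts = ts} _ gs , ℕ.s≤s h) ∷ ps) = All.++⁺ (All.zip (gs , below ts h)) (Fueled-S* ps)
    where
    below : ∀ ts → heightL ts ℕ.≤ n → All (λ t → height t ℕ.≤ n) ts
    below [] h = []
    below (t ∷ ts) h = ℕ.m⊔n≤o⇒m≤o (height t) (heightL ts) h ∷ below ts (ℕ.m⊔n≤o⇒n≤o (height t) (heightL ts) h)

  Fueled-0 : ∀ {w} → All (Fueled 0) w → w ≡ []
  Fueled-0 [] = ≡.refl
  Fueled-0 ((good _ _ , ()) ∷ _)

  Fueled-good : ∀ {n w} → All (Fueled n) w → All Good w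
  Fueled-good = All.map proj₁

  Fueled-height : ∀ {w} → All Good w → All (Fueled (heightL w)) w
  Fueled-height [] = []
  Fueled-height {t ∷ w} (g ∷ gs) =
    (g , ℕ.m≤m⊔n (height t) (heightL w))
    ∷ All.map (λ { (g′ , h) → g′ , ℕ.≤-trans h (ℕ.m≤n⊔m (height t) (heightL w)) }) (Fueled-height gs)

module SEIVariance {c ℓ₁ ℓ₂} (F : OrderedField c ℓ₁ ℓ₂) (B : ℕ) (1≤B : 1 ℕ.≤ B) where

  open OrderedField F
  open SEI F
  open FieldFacts F
  open FiniteSums F
  open Moments F
  open Subsets F
  open Trees F
  open SetoidReasoning setoid

  []-or-∷ : ∀ {a} {A : Set a} (xs : List A) → (xs ≡ []) ⊎ (xs ≢ [])
  []-or-∷ [] = inj₁ ≡.refl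
  []-or-∷ (x ∷ xs) = inj₂ (λ ())

  concatMap-congᴬ : ∀ {a b} {A : Set a} {X : Set b} {f g : A → List X} {xs} →
    All (λ x → f x ≡ g x) xs → concatMap f xs ≡ concatMap g xs
  concatMap-congᴬ [] = ≡.refl
  concatMap-congᴬ (e ∷ es) = ≡.cong₂ _++_ e (concatMap-congᴬ es)

  Dk : List Tree → List Tree → Carrier
  Dk xs ys = (∣ ys ∣ / ∣ xs ∣) * (r* (S* xs) / r* ys)

  next-D : Carrier → List Tree → List Tree → Carrier
  next-D Dₓ xs ys = Dₓ * Dk xs ys

  next-C : Carrier → Carrier → List Tree → List Tree → Carrier
  next-C Cₓ Dₓ xs ys = Cₓ + (c* ys / ∣ ys ∣) * next-D Dₓ xs ys

  iterate : ℕ → Carrier → Carrier → List Tree → Dist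
  iterate n Cₓ Dₓ xs =
    concatMap (λ py → weight (proj₁ py) (run B n (next-C Cₓ Dₓ xs (proj₂ py)) (next-D Dₓ xs (proj₂ py)) (proj₂ py))) (step B xs)

  run-leaf : ∀ n Cₓ Dₓ xs → S* xs ≡ [] → run B (suc n) Cₓ Dₓ xs ≡ (1# , Cₓ) ∷ []
  run-leaf n Cₓ Dₓ xs S*xs≡[] with S* xs
  run-leaf n Cₓ Dₓ xs ≡.refl | .[] = ≡.refl

  run-iterate : ∀ n Cₓ Dₓ xs → S* xs ≢ [] → run B (suc n) Cₓ Dₓ xs ≡ iterate n Cₓ Dₓ xs
  run-iterate n Cₓ Dₓ xs = unfold xs ≡.refl
    where
    -- run abstracts over S* xs, while the iteration it unfolds to still
    -- mentions S* xs; stating the goal for an equal copy xs′ keeps the two apart.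
    unfold : ∀ xs′ → xs ≡ xs′ → S* xs ≢ [] → run B (suc n) Cₓ Dₓ xs ≡ iterate n Cₓ Dₓ xs′
    unfold xs′ xs≡xs′ S*xs≢[] with S* xs
    ... | [] = ⊥-elim (S*xs≢[] ≡.refl)
    ... | _ ∷ _ with xs≡xs′
    ...   | ≡.refl = ≡.refl

  All-step : ∀ {p} {P : Tree → Set p} xs → All P (S* xs) → All (λ py → All P (proj₂ py)) (step B xs)
  All-step xs PS =
    All.concat⁺ (All.map⁺ (All.map (λ { (Px , Prest , _) → All.map⁺ (All.map (λ { (Pu , _) → Px ∷ Pu }) (All-choose (B ⊓ length (S* xs) ∸ 1) _ Prest)) })
                                    (All-picks (S* xs) PS)))

  run-fuel : ∀ n n′ Cₓ Dₓ xs → All (Fueled n) xs → All (Fueled n′) xs → run B n Cₓ Dₓ xs ≡ run B n′ Cₓ Dₓ xs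
  run-fuel zero n′ Cₓ Dₓ xs f f′ with Fueled-0 f
  run-fuel zero zero Cₓ Dₓ xs f f′ | ≡.refl = ≡.refl
  run-fuel zero (suc n′) Cₓ Dₓ xs f f′ | ≡.refl = ≡.refl
  run-fuel (suc n) zero Cₓ Dₓ xs f f′ with Fueled-0 f′
  ... | ≡.refl = ≡.refl
  run-fuel (suc n) (suc n′) Cₓ Dₓ xs f f′ with []-or-∷ (S* xs)
  ... | inj₁ leaf = ≡.trans (run-leaf n Cₓ Dₓ xs leaf) (≡.sym (run-leaf n′ Cₓ Dₓ xs leaf))
  ... | inj₂ S*xs≢[] =
    ≡.trans (run-iterate n Cₓ Dₓ xs S*xs≢[])
      (≡.trans (concatMap-congᴬ (All.zipWith (λ { (Pys , P′ys) → ≡.cong (weight _) (run-fuel n n′ _ _ _ Pys P′ys) })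
                                              (All-step xs (Fueled-S* f) , All-step xs (Fueled-S* f′))))
               (≡.sym (run-iterate n′ Cₓ Dₓ xs S*xs≢[])))

  moment-run-iterate : ∀ ψ n Cₓ Dₓ xs → S* xs ≢ [] →
    moment ψ (run B (suc n) Cₓ Dₓ xs)
      ≈ ΣL (λ py → proj₁ py * moment ψ (run B n (next-C Cₓ Dₓ xs (proj₂ py)) (next-D Dₓ xs (proj₂ py)) (proj₂ py))) (step B xs)
  moment-run-iterate ψ n Cₓ Dₓ xs S*xs≢[] =
    trans (reflexive (≡.cong (moment ψ) (run-iterate n Cₓ Dₓ xs S*xs≢[])))
      (trans (moment-concatMap ψ _ (step B xs)) (ΣL-cong (λ py → moment-weight ψ (proj₁ py) (run B n (next-C Cₓ Dₓ xs (proj₂ py)) (next-D Dₓ xs (proj₂ py)) (proj₂ py))) (step B xs)))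

  run-affine : ∀ n xs {φ} → Congruent φ → ∀ {a k b e Cₓ Dₓ} → Cₓ ≈ a + k * b → Dₓ ≈ k * e →
    moment φ (run B n Cₓ Dₓ xs) ≈ moment (λ x → φ (a + k * x)) (run B n b e xs)
  run-affine zero xs φ-cong Cₓ≈ Dₓ≈ = +-congʳ (*-congˡ (φ-cong Cₓ≈))
  run-affine (suc n) xs {φ} φ-cong {a} {k} {b} {e} {Cₓ} {Dₓ} Cₓ≈ Dₓ≈ with []-or-∷ (S* xs)
  ... | inj₁ leaf =
    trans (reflexive (≡.cong (moment φ) (run-leaf n Cₓ Dₓ xs leaf)))
      (trans (+-congʳ (*-congˡ (φ-cong Cₓ≈))) (reflexive (≡.cong (moment _) (≡.sym (run-leaf n b e xs leaf)))))
  ... | inj₂ S*xs≢[] =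
    trans (moment-run-iterate φ n Cₓ Dₓ xs S*xs≢[])
      (trans (ΣL-cong (λ py → *-congˡ (run-affine n (proj₂ py) φ-cong (Cₓ′≈ (proj₂ py)) (Dₓ′≈ (proj₂ py)))) (step B xs))
             (sym (moment-run-iterate _ n b e xs S*xs≢[])))
    where
    Dₓ′≈ : ∀ ys → next-D Dₓ xs ys ≈ k * next-D e xs ys
    Dₓ′≈ ys = trans (*-congʳ Dₓ≈) (*-assoc k e _)
    Cₓ′≈ : ∀ ys → next-C Cₓ Dₓ xs ys ≈ a + k * next-C b e xs ys
    Cₓ′≈ ys = trans (+-cong Cₓ≈ (*-congˡ (*-congʳ Dₓ≈)))
                   (solve 6 (λ a k b y e d → a :+ k :* b :+ y :* ((k :* e) :* d) := a :+ k :* (b :+ y :* (e :* d))) refl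
                          a k b (c* ys / ∣ ys ∣) e (Dk xs ys))

  Y : ℕ → List Tree → Dist
  Y n w = scaleBy ∣ w ∣ (run B n (c* w / ∣ w ∣) 1# w)

  Y-fuel : ∀ {n n′ w} → All (Fueled n) w → All (Fueled n′) w → Y n w ≡ Y n′ w
  Y-fuel {n} {n′} {w} f f′ = ≡.cong (scaleBy ∣ w ∣) (run-fuel n n′ _ _ w f f′)

  Y-leaf : ∀ n w φ → Congruent φ → All (Fueled n) w → S* w ≡ [] → moment φ (Y n w) ≈ φ (c* w)
  Y-leaf zero w φ φ-cong f _ with Fueled-0 f
  ... | ≡.refl = trans (+-identityʳ _) (trans (*-identityˡ _) (φ-cong (zeroˡ _)))
  Y-leaf (suc n) w φ φ-cong f leaf =
    trans (reflexive (≡.cong (λ d → moment φ (scaleBy ∣ w ∣ d)) (run-leaf n _ _ w leaf)))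
          (trans (+-identityʳ _) (trans (*-identityˡ _) (φ-cong (cancel w))))
    where
    cancel : ∀ w → ∣ w ∣ * (c* w / ∣ w ∣) ≈ c* w
    cancel [] = zeroˡ _
    cancel (t ∷ w) = *-/-cancel (c* (t ∷ w)) (∣∣≉0 {t ∷ w} (λ ()))

  ρ : List Tree → List Tree → Carrier
  ρ w u = r* (S* w) / r* u

  Y-step : ∀ n w φ → Congruent φ → S* w ≢ [] →
    moment φ (Y (suc n) w) ≈ ΣL (λ py → proj₁ py * moment (λ z → φ (c* w + ρ w (proj₂ py) * z)) (Y n (proj₂ py))) (step B w)
  Y-step n w φ φ-cong S*w≢[] = begin
    moment φ (Y (suc n) w)
      ≡⟨ moment-scaleBy φ ∣ w ∣ (run B (suc n) C₀ 1# w) ⟩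
    moment φ′ (run B (suc n) C₀ 1# w)
      ≈⟨ moment-run-iterate φ′ n C₀ 1# w S*w≢[] ⟩
    ΣL (λ py → proj₁ py * moment φ′ (run B n (next-C C₀ 1# w (proj₂ py)) (next-D 1# w (proj₂ py)) (proj₂ py))) (step B w)
      ≈⟨ ΣL-cong (λ py → *-congˡ (after-step (proj₂ py))) (step B w) ⟩
    ΣL (λ py → proj₁ py * moment (λ z → φ (c* w + ρ w (proj₂ py) * z)) (Y n (proj₂ py))) (step B w) ∎
    where
    C₀ = c* w / ∣ w ∣
    φ′ : Carrier → Carrier
    φ′ x = φ (∣ w ∣ * x)
    rescale : ∀ ys x → ∣ w ∣ * (C₀ + Dk w ys * x) ≈ c* w + ρ w ys * (∣ ys ∣ * x)
    rescale ys x =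
      trans (solve 6 (λ W Wi cw Yl R x → W :* (cw :* Wi :+ ((Yl :* Wi) :* R) :* x) := (W :* (cw :* Wi)) :+ R :* (Yl :* x) :* (W :* Wi)) refl
                     (∣ w ∣) (∣ w ∣ ⁻¹) (c* w) (∣ ys ∣) (ρ w ys) x)
            (+-cong (*-/-cancel (c* w) ∣w∣≉0) (trans (*-congˡ (⁻¹-inverse ∣ w ∣ ∣w∣≉0)) (*-identityʳ _)))
      where ∣w∣≉0 = ∣∣≉0 (S*≢[]⇒≢[] {w} S*w≢[])
    after-step : ∀ ys → moment φ′ (run B n (next-C C₀ 1# w ys) (next-D 1# w ys) ys)
                        ≈ moment (λ z → φ (c* w + ρ w ys * z)) (Y n ys)
    after-step ys = begin
      moment φ′ (run B n (next-C C₀ 1# w ys) (next-D 1# w ys) ys)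
        ≈⟨ run-affine n ys (λ e → φ-cong (*-congˡ e))
                      (+-congˡ (trans (*-congˡ (*-identityˡ _)) (*-comm _ _))) (trans (*-identityˡ _) (sym (*-identityʳ _))) ⟩
      moment (λ x → φ′ (C₀ + Dk w ys * x)) (run B n (c* ys / ∣ ys ∣) 1# ys)
        ≈⟨ moment-congφ (λ x → φ-cong (rescale ys x)) (run B n (c* ys / ∣ ys ∣) 1# ys) ⟩
      moment (λ x → φ (c* w + ρ w ys * (∣ ys ∣ * x))) (run B n (c* ys / ∣ ys ∣) 1# ys)
        ≡⟨ moment-scaleBy (λ z → φ (c* w + ρ w ys * z)) ∣ ys ∣ (run B n (c* ys / ∣ ys ∣) 1# ys) ⟨
      moment (λ z → φ (c* w + ρ w ys * z)) (Y n ys) ∎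

  -- Size data of a step from a hypernode with children S: the new
  -- hypernode has width S elements, each first choice x is completed in
  -- N S ways, and K S = 1 / (r(S) · N S) normalises the step probabilities.
  width : List Tree → ℕ
  width S = B ⊓ length S

  N : List Tree → Carrier
  N S = fromℕ ((length S ∸ 1) C (width S ∸ 1))

  K : List Tree → Carrier
  K S = r* S ⁻¹ * N S ⁻¹

  -- 1 ≤ B makes the width of a nonempty S positive.
  width-suc : ∀ S → S ≢ [] → suc (width S ∸ 1) ≡ width S
  width-suc [] S≢[] = ⊥-elim (S≢[] ≡.refl)
  width-suc (x ∷ xs) _ = suc-∸1 (ℕ.⊓-glb 1≤B (ℕ.s≤s ℕ.z≤n))
    where
    suc-∸1 : ∀ {n} → 1 ℕ.≤ n → suc (n ∸ 1) ≡ n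
    suc-∸1 (ℕ.s≤s _) = ≡.refl

  C-pos : ∀ n k → k ℕ.≤ n → 1 ℕ.≤ n C k
  C-pos n zero _ = ℕ.≤-refl
  C-pos (suc n) (suc k) (ℕ.s≤s k≤n) =
    ℕ.≤-trans (C-pos n k k≤n) (ℕ.≤-trans (ℕ.m≤m+n (n C k) (n C suc k)) (ℕ.≤-reflexive (nCk+nC[k+1]≡[n+1]C[k+1] n k)))

  N≉0 : ∀ S → ¬ (N S ≈ 0#)
  N≉0 S = fromℕ≉0 (C-pos (length S ∸ 1) (width S ∸ 1) (ℕ.∸-monoˡ-≤ 1 (ℕ.m⊓n≤n B (length S))))

  step-as-picks : ∀ w (g : List Tree → Carrier) →
    ΣL (λ py → proj₁ py * g (proj₂ py)) (step B w) ≈ K (S* w) * ΣL (picked imp (width (S* w) ∸ 1) g) (picks (S* w))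
  step-as-picks w g =
    trans (ΣL-concatMap (λ py → proj₁ py * g (proj₂ py)) _ (picks S))
      (trans (ΣL-congᴬ (All.map pick (All-picks S (All.universal (λ _ → tt) S)))) (ΣL-*ˡ (K S) (picked imp k g) (picks S)))
    where
    S = S* w
    k = width S ∸ 1
    pick : ∀ {xr} → _ × _ × (suc (length (proj₂ xr)) ≡ length S) →
      ΣL (λ py → proj₁ py * g (proj₂ py))
         (map (λ u → (imp (proj₁ xr) / r* S) * (1# / fromℕ (length (choose k (proj₂ xr)))) , proj₁ xr ∷ u) (choose k (proj₂ xr)))
      ≈ K S * picked imp k g xr
    pick {x , rest} (_ , _ , len) =
      trans (reflexive (ΣL-map _ _ (choose k rest)))
        (trans (ΣL-cong (λ u → trans (*-congʳ (*-congˡ (trans (*-identityˡ _) (⁻¹-cong (reflexive (≡.cong fromℕ completions))))))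
                                     (solve 4 (λ i Ri Ni y → (i :* Ri) :* Ni :* y := (Ri :* Ni) :* (i :* y)) refl
                                            (imp x) (r* S ⁻¹) (N S ⁻¹) (g (x ∷ u))))
                        (choose k rest))
               (ΣL-*ˡ (K S) _ (choose k rest)))
      where
      completions : length (choose k rest) ≡ (length S ∸ 1) C k
      completions = ≡.trans (length-choose k rest) (≡.cong (λ l → (l ∸ 1) C k) len)

  G : (Carrier → Carrier) → ℕ → List Tree → List Tree → Carrier
  G φ n w u = moment (λ z → φ (c* w + ρ w u * z)) (Y n u)

  -- First-step decomposition: E φ(|𝐰| C) = K · ∑_{𝐮 ∈ H(𝐰)} r(𝐮) G(𝐮).
  -- It needs G to be symmetric, since the step reaches 𝐮 in every order.
  collect : ∀ {p} {P : Tree → Set p} n w φ → Congruent φ → All P (S* w) → S* w ≢ [] → Symmetric P (G φ n w) →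
    moment φ (Y (suc n) w) ≈ K (S* w) * ΣL (λ u → r* u * G φ n w u) (choose (width (S* w)) (S* w))
  collect n w φ φ-cong PS S*w≢[] G-sym = begin
    moment φ (Y (suc n) w)
      ≈⟨ Y-step n w φ φ-cong S*w≢[] ⟩
    ΣL (λ py → proj₁ py * G φ n w (proj₂ py)) (step B w)
      ≈⟨ step-as-picks w (G φ n w) ⟩
    K S * ΣL (picked imp (width S ∸ 1) (G φ n w)) (picks S)
      ≈⟨ *-congˡ (picks-choose imp (width S ∸ 1) S (G φ n w) PS G-sym) ⟩
    K S * ΣL (λ u → ΣL imp u * G φ n w u) (choose (suc (width S ∸ 1)) S)
      ≡⟨ ≡.cong (λ j → K S * ΣL (λ u → ΣL imp u * G φ n w u) (choose j S)) (width-suc S S*w≢[]) ⟩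
    K S * ΣL (λ u → ΣL imp u * G φ n w u) (choose (width S) S)
      ≈⟨ *-congˡ (ΣL-cong (λ u → *-congʳ (reflexive (≡.sym (Σ-map imp u)))) (choose (width S) S)) ⟩
    K S * ΣL (λ u → r* u * G φ n w u) (choose (width S) S) ∎
    where S = S* w

  Invariant : ℕ → Set _
  Invariant n = ∀ φ → Congruent φ → Symmetric (Fueled n) (λ u → moment φ (Y n u))

  G-symmetric : ∀ {n w φ} → Invariant n → Congruent φ → Symmetric (Fueled n) (G φ n w)
  G-symmetric {n} {w} {φ} inv φ-cong {u} {u′} Pu u↭u′ =
    trans (moment-congφ (λ z → φ-cong (+-congˡ (*-congʳ (*-congˡ (⁻¹-cong (r*-↭ u↭u′)))))) (Y n u))
          (inv _ (λ e → φ-cong (+-congˡ (*-congˡ e))) Pu u↭u′)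

  G-↭ : ∀ {n w w′ φ} → Congruent φ → w ↭ w′ → ∀ u → G φ n w u ≈ G φ n w′ u
  G-↭ {n} φ-cong w↭w′ u =
    moment-congφ (λ z → φ-cong (+-cong (c*-↭ w↭w′) (*-congʳ (*-congʳ (r*-↭ (S*-↭ w↭w′)))))) (Y n u)

  -- Induction on the fuel: a leaf gives φ(c(𝐰)); otherwise the first-step
  -- decompositions for 𝐰 and 𝐰′ agree term by term once the subsets of
  -- S(𝐰) are matched with those of S(𝐰′) (choose-↭).
  perm-invariant : ∀ n → Invariant n
  perm-invariant n φ φ-cong {w} {w′} f w↭w′ with []-or-∷ (S* w)
  ... | inj₁ leaf =
    trans (Y-leaf n w φ φ-cong f leaf)
      (trans (φ-cong (c*-↭ w↭w′)) (sym (Y-leaf n w′ φ φ-cong (↭.All-resp-↭ w↭w′ f) leaf′)))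
    where
    leaf′ : S* w′ ≡ []
    leaf′ = ↭.↭-empty-inv (↭-sym (≡.subst (_↭ S* w′) leaf (S*-↭ w↭w′)))
  perm-invariant zero φ φ-cong {w} f w↭w′ | inj₂ S*w≢[] = ⊥-elim (S*≢[]⇒≢[] {w} S*w≢[] (Fueled-0 f))
  perm-invariant (suc m) φ φ-cong {w} {w′} f w↭w′ | inj₂ S*w≢[] = begin
    moment φ (Y (suc m) w)
      ≈⟨ collect m w φ φ-cong (Fueled-S* f) S*w≢[] (G-symmetric {m} {w} (perm-invariant m) φ-cong) ⟩
    K S * ΣL h (choose (width S) S)
      ≈⟨ *-cong K≈ (choose-↭ (width S) h (Fueled-S* f) h-sym S↭S′) ⟩
    K S′ * ΣL h (choose (width S) S′)
      ≡⟨ ≡.cong (λ l → K S′ * ΣL h (choose (B ⊓ l) S′)) ∣S∣≡∣S′∣ ⟩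
    K S′ * ΣL h (choose (width S′) S′)
      ≈⟨ *-congˡ (ΣL-cong (λ u → *-congˡ (G-↭ {m} {w} {w′} φ-cong w↭w′ u)) (choose (width S′) S′)) ⟩
    K S′ * ΣL (λ u → r* u * G φ m w′ u) (choose (width S′) S′)
      ≈⟨ collect m w′ φ φ-cong (Fueled-S* f′) S*w′≢[] (G-symmetric {m} {w′} (perm-invariant m) φ-cong) ⟨
    moment φ (Y (suc m) w′) ∎
    where
    S = S* w
    S′ = S* w′
    f′ = ↭.All-resp-↭ w↭w′ f
    S↭S′ = S*-↭ w↭w′
    ∣S∣≡∣S′∣ = ↭.↭-length S↭S′
    S*w′≢[] : S′ ≢ []
    S*w′≢[] S′≡[] = S*w≢[] (↭.↭-empty-inv (≡.subst (S ↭_) S′≡[] S↭S′))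
    h : List Tree → Carrier
    h u = r* u * G φ m w u
    h-sym : Symmetric (Fueled m) h
    h-sym Pu u↭u′ = *-cong (r*-↭ u↭u′) (G-symmetric {m} {w} (perm-invariant m) φ-cong Pu u↭u′)
    K≈ : K S ≈ K S′
    K≈ = *-cong (⁻¹-cong (r*-↭ S↭S′))
                (⁻¹-cong (reflexive (≡.cong (λ l → fromℕ ((l ∸ 1) C ((B ⊓ l) ∸ 1))) ∣S∣≡∣S′∣)))

  subset-≢[] : ∀ {S u : List Tree} → S ≢ [] → length u ≡ width S → u ≢ []
  subset-≢[] {S} S≢[] ∣u∣≡width ≡.refl with ≡.trans ∣u∣≡width (≡.sym (width-suc S S≢[]))
  ... | ()

  -- Averaging over the hyperchildren: ∑_{𝐮} r(𝐮) and ∑_{𝐮} Cost(T_𝐮) count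
  -- every child N S times, so K normalises the first to 1.
  module Average (S : List Tree) (S-good : All Good S) (S≢[] : S ≢ []) where
    R = r* S
    CS = Cost* S
    subsets = choose (width S) S

    ΣL-subsets : ∀ (f : Tree → Carrier) → ΣL (ΣL f) subsets ≈ N S * ΣL f S
    ΣL-subsets f = trans (reflexive (≡.cong (λ j → ΣL (ΣL f) (choose j S)) (≡.sym (width-suc S S≢[]))))
                         (ΣL-choose-ΣL f (width S ∸ 1) S)

    average : ∀ α β → K S * ΣL (λ u → α * r* u + (β * R) * Cost* u) subsets ≈ α + β * CS
    average α β = begin
      K S * ΣL (λ u → α * r* u + (β * R) * Cost* u) subsets
        ≈⟨ *-congˡ (trans (ΣL-+ _ _ subsets) (+-cong (ΣL-*ˡ α r* subsets) (ΣL-*ˡ (β * R) Cost* subsets))) ⟩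
      K S * (α * ΣL r* subsets + (β * R) * ΣL Cost* subsets)
        ≈⟨ *-congˡ (+-cong (*-congˡ Σr) (*-congˡ ΣCost)) ⟩
      K S * (α * (N S * R) + (β * R) * (N S * CS))
        ≈⟨ solve 7 (λ Ri Ni α β N R C → (Ri :* Ni) :* (α :* (N :* R) :+ (β :* R) :* (N :* C))
                                        := ((R :* Ri) :* (N :* Ni)) :* (α :+ β :* C)) refl
                 (R ⁻¹) (N S ⁻¹) α β (N S) R CS ⟩
      ((R * R ⁻¹) * (N S * N S ⁻¹)) * (α + β * CS)
        ≈⟨ *-congʳ (*-cong (⁻¹-inverse R (r*≉0 S-good S≢[])) (⁻¹-inverse (N S) (N≉0 S))) ⟩
      (1# * 1#) * (α + β * CS)
        ≈⟨ trans (*-congʳ (*-identityˡ 1#)) (*-identityˡ _) ⟩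
      α + β * CS ∎
      where
      Σr : ΣL r* subsets ≈ N S * R
      Σr = trans (ΣL-cong (λ u → reflexive (Σ-map imp u)) subsets)
                 (trans (ΣL-subsets imp) (*-congˡ (reflexive (≡.sym (Σ-map imp S)))))
      ΣCost : ΣL Cost* subsets ≈ N S * CS
      ΣCost = trans (ΣL-cong (λ u → reflexive (Costs≡ΣL u)) subsets)
                    (trans (ΣL-subsets Cost) (*-congˡ (reflexive (≡.sym (Costs≡ΣL S)))))

  Hyperchild : ℕ → List Tree → List Tree → Set _
  Hyperchild m S u = All (Fueled m) u × (length u ≡ width S)

  hyperchild-r≉0 : ∀ {m S u} → S ≢ [] → Hyperchild m S u → ¬ (r* u ≈ 0#)
  hyperchild-r≉0 S≢[] (Pu , ∣u∣) = r*≉0 (Fueled-good Pu) (subset-≢[] S≢[] ∣u∣)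

  mass-step : ∀ m w → All (Fueled (suc m)) w → S* w ≢ [] →
    (∀ {u} → All (Fueled m) u → mass (Y m u) ≈ 1#) → mass (Y (suc m) w) ≈ 1#
  mass-step m w f S*w≢[] mass≈1 = begin
    mass (Y (suc m) w)
      ≈⟨ collect m w (λ _ → 1#) (λ _ → refl) PS S*w≢[] (G-symmetric {m} {w} (perm-invariant m) (λ _ → refl)) ⟩
    K S * ΣL (λ u → r* u * mass (Y m u)) subsets
      ≈⟨ *-congˡ (ΣL-congᴬ (All.map pointwise (All-choose (width S) S PS))) ⟩
    K S * ΣL (λ u → 1# * r* u + (0# * R) * Cost* u) subsets
      ≈⟨ average 1# 0# ⟩
    1# + 0# * CS
      ≈⟨ trans (+-congˡ (zeroˡ CS)) (+-identityʳ 1#) ⟩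
    1# ∎
    where
    S = S* w
    PS = Fueled-S* f
    open Average S (Fueled-good PS) S*w≢[]
    pointwise : ∀ {u} → Hyperchild m S u → r* u * mass (Y m u) ≈ 1# * r* u + (0# * R) * Cost* u
    pointwise (Pu , _) = trans (trans (*-congˡ (mass≈1 Pu)) (*-comm _ _))
                               (sym (trans (+-congˡ (trans (*-congʳ (zeroˡ R)) (zeroˡ _))) (+-identityʳ _)))

  mean-step : ∀ m w → All (Fueled (suc m)) w → S* w ≢ [] →
    (∀ {u} → All (Fueled m) u → (mass (Y m u) ≈ 1#) × (mean (Y m u) ≈ Cost* u)) → mean (Y (suc m) w) ≈ Cost* w
  mean-step m w f S*w≢[] moments = begin
    mean (Y (suc m) w)
      ≈⟨ collect m w (λ x → x) (λ e → e) PS S*w≢[] (G-symmetric {m} {w} (perm-invariant m) (λ e → e)) ⟩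
    K S * ΣL (λ u → r* u * G (λ x → x) m w u) subsets
      ≈⟨ *-congˡ (ΣL-congᴬ (All.map pointwise (All-choose (width S) S PS))) ⟩
    K S * ΣL (λ u → a * r* u + (1# * R) * Cost* u) subsets
      ≈⟨ average a 1# ⟩
    a + 1# * CS
      ≈⟨ trans (+-congˡ (*-identityˡ CS)) (sym (Cost*-split w)) ⟩
    Cost* w ∎
    where
    S = S* w
    a = c* w
    PS = Fueled-S* f
    open Average S (Fueled-good PS) S*w≢[]
    pointwise : ∀ {u} → Hyperchild m S u → r* u * G (λ x → x) m w u ≈ a * r* u + (1# * R) * Cost* u
    pointwise {u} 𝐮@(Pu , _) = begin
      r* u * G (λ x → x) m w u
        ≈⟨ *-congˡ (moment-affine a (ρ w u) (Y m u)) ⟩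
      r* u * (a * mass (Y m u) + ρ w u * mean (Y m u))
        ≈⟨ *-congˡ (+-cong (*-congˡ (proj₁ (moments Pu))) (*-congˡ (proj₂ (moments Pu)))) ⟩
      r* u * (a * 1# + (R * r* u ⁻¹) * Cost* u)
        ≈⟨ solve 6 (λ X Xi a R C one → X :* (a :* one :+ (R :* Xi) :* C) := (a :* X) :* one :+ (R :* C) :* (X :* Xi)) refl
                 (r* u) (r* u ⁻¹) a R (Cost* u) 1# ⟩
      (a * r* u) * 1# + (R * Cost* u) * (r* u * r* u ⁻¹)
        ≈⟨ +-cong (*-identityʳ _) (trans (*-congˡ (⁻¹-inverse (r* u) (hyperchild-r≉0 S*w≢[] 𝐮)))
                                         (trans (*-identityʳ _) (*-congʳ (sym (*-identityˡ R))))) ⟩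
      a * r* u + (1# * R) * Cost* u ∎

  first-moments : ∀ n w → All (Fueled n) w → (mass (Y n w) ≈ 1#) × (mean (Y n w) ≈ Cost* w)
  first-moments n w f with []-or-∷ (S* w)
  ... | inj₁ leaf =
    Y-leaf n w (λ _ → 1#) (λ _ → refl) f leaf ,
    trans (Y-leaf n w (λ x → x) (λ e → e) f leaf)
          (sym (trans (Cost*-split w) (trans (+-congˡ (reflexive (≡.cong Costs leaf))) (+-identityʳ _))))
  first-moments zero w f | inj₂ S*w≢[] = ⊥-elim (S*≢[]⇒≢[] {w} S*w≢[] (Fueled-0 f))
  first-moments (suc m) w f | inj₂ S*w≢[] =
    mass-step m w f S*w≢[] (λ {u} Pu → proj₁ (first-moments m u Pu)) ,
    mean-step m w f S*w≢[] (λ {u} Pu → first-moments m u Pu)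

  Var+Cost² : ∀ {n u} → All (Fueled n) u → Var (Y n u) + Cost* u * Cost* u ≈ second (Y n u)
  Var+Cost² {n} {u} Pu = begin
    Var (Y n u) + Cost* u * Cost* u
      ≡⟨ ≡.cong (_+ Cost* u * Cost* u) (Var≡ (Y n u)) ⟩
    (second (Y n u) - mean (Y n u) * mean (Y n u)) + Cost* u * Cost* u
      ≈⟨ +-congʳ (+-congˡ (-‿cong (*-cong mean≈ mean≈))) ⟩
    (second (Y n u) - Cost* u * Cost* u) + Cost* u * Cost* u
      ≈⟨ solve 2 (λ s c → s :- c :+ c := s) refl (second (Y n u)) (Cost* u * Cost* u) ⟩
    second (Y n u) ∎
    where mean≈ = proj₂ (first-moments n u Pu)

  -- The part of E (|𝐯| C)² coming from the randomness below the hyperchild 𝐮.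
  excess : ℕ → List Tree → List Tree → Carrier
  excess m v u = (r* (S* v) * ρ v u) * second (Y m u)

  second-step : ∀ m v → All (Fueled (suc m)) v → S* v ≢ [] →
    second (Y (suc m) v)
      ≈ (c* v * c* v + (c* v + c* v) * Cost* (S* v)) + K (S* v) * ΣL (excess m v) (choose (width (S* v)) (S* v))
  second-step m v f S*v≢[] = begin
    second (Y (suc m) v)
      ≈⟨ collect m v sq sq-cong PS S*v≢[] (G-symmetric {m} {v} (perm-invariant m) sq-cong) ⟩
    K S * ΣL (λ u → r* u * G sq m v u) subsets
      ≈⟨ *-congˡ (ΣL-congᴬ (All.map pointwise (All-choose (width S) S PS))) ⟩
    K S * ΣL (λ u → (a * a * r* u + ((a + a) * R) * Cost* u) + excess m v u) subsets
      ≈⟨ trans (*-congˡ (ΣL-+ _ (excess m v) subsets)) (distribˡ _ _ _) ⟩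
    K S * ΣL (λ u → a * a * r* u + ((a + a) * R) * Cost* u) subsets + K S * ΣL (excess m v) subsets
      ≈⟨ +-congʳ (average (a * a) (a + a)) ⟩
    (a * a + (a + a) * CS) + K S * ΣL (excess m v) subsets ∎
    where
    S = S* v
    a = c* v
    PS = Fueled-S* f
    open Average S (Fueled-good PS) S*v≢[]
    pointwise : ∀ {u} → Hyperchild m S u →
                r* u * G sq m v u ≈ (a * a * r* u + ((a + a) * R) * Cost* u) + excess m v u
    pointwise {u} 𝐮@(Pu , _) = begin
      r* u * G sq m v u
        ≈⟨ *-congˡ (moment-quadratic a (ρ v u) (Y m u)) ⟩
      r* u * ((a * a) * mass (Y m u) + ((a + a) * ρ v u) * mean (Y m u) + (ρ v u * ρ v u) * second (Y m u))
        ≈⟨ *-congˡ (+-congʳ (+-cong (*-congˡ (proj₁ (first-moments m u Pu))) (*-congˡ (proj₂ (first-moments m u Pu))))) ⟩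
      r* u * ((a * a) * 1# + ((a + a) * ρ v u) * Cost* u + (ρ v u * ρ v u) * second (Y m u))
        ≈⟨ solve 8 (λ X Xi A B2 R C M one →
                      X :* (A :* one :+ (B2 :* (R :* Xi)) :* C :+ ((R :* Xi) :* (R :* Xi)) :* M)
                      := (A :* X) :* one :+ ((B2 :* R) :* C) :* (X :* Xi) :+ ((R :* (R :* Xi)) :* M) :* (X :* Xi)) refl
                 (r* u) (r* u ⁻¹) (a * a) (a + a) R (Cost* u) (second (Y m u)) 1# ⟩
      (a * a * r* u) * 1# + (((a + a) * R) * Cost* u) * (r* u * r* u ⁻¹) + excess m v u * (r* u * r* u ⁻¹)
        ≈⟨ +-cong (+-cong (*-identityʳ _) (cancel _)) (cancel _) ⟩
      (a * a * r* u + ((a + a) * R) * Cost* u) + excess m v u ∎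
      where
      cancel : ∀ x → x * (r* u * r* u ⁻¹) ≈ x
      cancel x = trans (*-congˡ (⁻¹-inverse (r* u) (hyperchild-r≉0 S*v≢[] 𝐮))) (*-identityʳ x)

  term : List Tree → List Tree → Carrier
  term v w = (1# / fromℕ ((length (S* v) ∸ 1) C (length w ∸ 1))) * (r* (S* v) / r* w)
             * (Var (scaleBy ∣ w ∣ (CSEI B w)) + Cost* w * Cost* w)

  -- The normalised excess is the sum in the theorem: K · r(S(𝐯)) · ρ = ρ / N,
  -- and E (|𝐮| C′)² = Var + Cost(T_𝐮)² whatever the fuel.
  excess-average : ∀ m v → All (Fueled (suc m)) v → S* v ≢ [] →
    K (S* v) * ΣL (excess m v) (choose (width (S* v)) (S* v)) ≈ Σ (map (term v) (H B v))
  excess-average m v f S*v≢[] = begin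
    K S * ΣL (excess m v) subsets            ≈⟨ ΣL-*ˡ (K S) (excess m v) subsets ⟨
    ΣL (λ u → K S * excess m v u) subsets    ≈⟨ ΣL-congᴬ (All.map per-term (All-choose (width S) S PS)) ⟩
    ΣL (term v) subsets                      ≡⟨ Σ-map (term v) subsets ⟨
    Σ (map (term v) (H B v))                 ∎
    where
    S = S* v
    PS = Fueled-S* f
    open Average S (Fueled-good PS) S*v≢[]
    per-term : ∀ {u} → Hyperchild m S u → K S * excess m v u ≈ term v u
    per-term {u} (Pu , ∣u∣) = begin
      (R ⁻¹ * N S ⁻¹) * ((R * ρ v u) * second (Y m u))
        ≈⟨ solve 5 (λ Ri Ni R p M → (Ri :* Ni) :* ((R :* p) :* M) := (R :* Ri) :* ((Ni :* p) :* M)) refl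
                 (R ⁻¹) (N S ⁻¹) R (ρ v u) (second (Y m u)) ⟩
      (R * R ⁻¹) * ((N S ⁻¹ * ρ v u) * second (Y m u))
        ≈⟨ trans (*-congʳ (⁻¹-inverse R (r*≉0 (Fueled-good PS) S*v≢[]))) (*-identityˡ _) ⟩
      (N S ⁻¹ * ρ v u) * second (Y m u)
        ≈⟨ *-cong (*-congʳ N⁻¹≈) (sym (trans (Var+Cost² h-fuel) (reflexive (≡.cong second (Y-fuel h-fuel Pu))))) ⟩
      term v u ∎
      where
      h-fuel = Fueled-height (Fueled-good Pu)
      N⁻¹≈ : N S ⁻¹ ≈ 1# / fromℕ ((length S ∸ 1) C (length u ∸ 1))
      N⁻¹≈ = trans (sym (*-identityˡ _))
                   (*-congˡ (⁻¹-cong (reflexive (≡.cong (λ l → fromℕ ((length S ∸ 1) C (l ∸ 1))) (≡.sym ∣u∣)))))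

  variance-fueled : ∀ n v → All (Fueled n) v → S* v ≢ [] →
    Var (Y n v) ≈ Σ (map (term v) (H B v)) - Cost* (S* v) * Cost* (S* v)
  variance-fueled zero v f S*v≢[] = ⊥-elim (S*≢[]⇒≢[] {v} S*v≢[] (Fueled-0 f))
  variance-fueled (suc m) v f S*v≢[] = begin
    Var (Y (suc m) v)
      ≡⟨ Var≡ (Y (suc m) v) ⟩
    second (Y (suc m) v) - mean (Y (suc m) v) * mean (Y (suc m) v)
      ≈⟨ +-cong (second-step m v f S*v≢[]) (-‿cong (*-cong mean≈ mean≈)) ⟩
    ((a * a + (a + a) * CS) + Z) - (a + CS) * (a + CS)
      ≈⟨ solve 3 (λ a C Z → ((a :* a :+ (a :+ a) :* C) :+ Z) :- (a :+ C) :* (a :+ C) := Z :- C :* C) refl a CS Z ⟩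
    Z - CS * CS
      ≈⟨ +-congʳ (excess-average m v f S*v≢[]) ⟩
    Σ (map (term v) (H B v)) - CS * CS ∎
    where
    a = c* v
    CS = Cost* (S* v)
    Z = K (S* v) * ΣL (excess m v) (choose (width (S* v)) (S* v))
    mean≈ : mean (Y (suc m) v) ≈ a + CS
    mean≈ = trans (proj₂ (first-moments (suc m) v f)) (Cost*-split v)

  variance-formula : ∀ v → All Good v → S* v ≢ [] →
    Var (scaleBy ∣ v ∣ (CSEI B v)) ≈ Σ (map (term v) (H B v)) - Cost* (S* v) * Cost* (S* v)
  variance-formula v v-good = variance-fueled (heightL v) v (Fueled-height v-good)

theorem4 : ∀ {c ℓ₁ ℓ₂ : Level} (F : OrderedField c ℓ₁ ℓ₂) →
    let open OrderedField F
        open SEI F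
    in (B : ℕ) → 1 Data.Nat.≤ B →
       (T : Tree) →
       All (λ u → (0# ≤ cst u) × (0# < imp u)) (nodes T) →
       (d : ℕ) (v : List Tree) → v ⊆ level d T →
       S* v ≢ [] →
       Var (scaleBy ∣ v ∣ (CSEI B v))
         ≈ Σ (map (λ w → (1# / fromℕ ((length (S* v) ∸ 1) C (length w ∸ 1)))
                         * (r* (S* v) / r* w)
                         * (Var (scaleBy ∣ w ∣ (CSEI B w)) + Cost* w * Cost* w))
                  (H B v))
           - Cost* (S* v) * Cost* (S* v)
theorem4 F B 1≤B T T-weights d v v⊆level S*v≢[] =
  SEIVariance.variance-formula F B 1≤B v v-good S*v≢[]
  where
  open Trees F using (good-nodes; good-level)
  v-good = Sublist.All-resp-⊆ v⊆level (good-level d T (good-nodes T T-weights))
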